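{- Let $k \geq 2$, $t \geq 1$ and $j \geq 1$ be integers, let $\sigma_1 = (1\,2\ldots k)^t$ and $\sigma_2 = (k\ldots 2\,1)^t$, and for $i=1,2$ let $\gamma_i$ be obtained from $\sigma_i$ by replacing every letter with $j$ adjacent copies of itself. Then $dfw(\{\gamma_1,\gamma_2\}) = 2t-1$.
   Context: An ordered sequence is a finite sequence over a totally ordered alphabet; $S$ order-contains $u$ if some subsequence of $S$ is obtained from $u$ by an injective order-preserving renaming of letters. A $j$-fat permutation on $r$ symbols is a sequence with $r$ distinct letters, each occurring exactly $j$ times; a $j$-tuple $(r,s)$-formation is a concatenation of $s$ $j$-fat permutations on the same $r$ symbols. For a family $F$ of ordered sequences, $dfw(F)$ is the minimum $s$ for which there exists $r$ such that every $r$-tuple $(r,s)$-formation (over an ordered alphabet of $r$ symbols) order-contains at least one member of $F$. $w^t$ denotes the concatenation of $t$ copies of $w$. -}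

module Defs where

open import Data.Nat using (ℕ; suc; _<_; _≤_; _≟_)
open import Data.List using (List; []; _∷_; map; concat; concatMap; replicate; reverse; upTo; length; filter)
open import Data.List.Membership.Propositional using (_∈_)
open import Data.List.Relation.Unary.All using (All)
open import Data.List.Relation.Unary.Any using (Any)
open import Data.List.Relation.Binary.Sublist.Propositional using (_⊆_)
open import Data.Product using (Σ; ∃; _×_)
open import Relation.Binary.PropositionalEquality using (_≡_)

Seq : Set
Seq = List ℕ

count : ℕ → Seq → ℕ
count a w = length (filter (a ≟_) w)

-- S order-contains u: some subsequence of S is the image of u under a
-- renaming f that is strictly order-preserving (hence injective) on the
-- letters of u.
OrderContains : Seq → Seq → Set
OrderContains S u =
  Σ (ℕ → ℕ) λ f →
    (∀ {x y} → x ∈ u → y ∈ u → x < y → f x < f y) × (map f u ⊆ S)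

FatPerm : ℕ → ℕ → Seq → Set
FatPerm j r w = (∀ {x} → x ∈ w → x < r) × (∀ a → a < r → count a w ≡ j)

Formation : ℕ → ℕ → ℕ → Seq → Set
Formation j r s S =
  Σ (List Seq) λ ws → (length ws ≡ s) × All (FatPerm j r) ws × (S ≡ concat ws)

DfwHolds : List Seq → ℕ → Set
DfwHolds F s = ∃ λ r → ∀ S → Formation r r s S → Any (OrderContains S) F

DfwIs : List Seq → ℕ → Set
DfwIs F d = DfwHolds F d × (∀ s → DfwHolds F s → d ≤ s)

pow : Seq → ℕ → Seq
pow w t = concat (replicate t w)

blowUp : ℕ → Seq → Seq
blowUp j = concatMap (replicate j)

incr : ℕ → Seq
incr k = map suc (upTo k)

decr : ℕ → Seq
decr k = reverse (incr k)

module Submission where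

-- Upper bound: in an r-fat permutation, any set K of letters with |K|·j ≤ r can be ordered
-- greedily so that the j-fold blow-up of the order is a subsequence, and by Erdős–Szekeres a
-- large monotone part of that order survives. Starting from enough letters, k letters survive
-- all 2t−1 blocks, each block showing their blow-up increasing or decreasing; t blocks agree,
-- which gives γ₁ or γ₂. Lower bound: alternate the ascending and the descending fat
-- permutation s times. An occurrence of γ₁ or γ₂ gives a word a c a c … of length 2t with
-- a < c, and a monotone block holds at most two consecutive letters of it, two only when the
-- word enters the block in the block's direction; hence 2t ≤ s + 1.

open import Defs
open import Data.Bool using (Bool; true; false; if_then_else_)
open import Data.Empty using (⊥-elim)
open import Data.List
  using (List; []; _∷_; _++_; map; concat; concatMap; replicate; reverse; upTo; downFrom; applyUpTo; length; filter; take)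
open import Data.List.Properties
  using (length-++; filter-++; filter-accept; filter-reject; filter-none; filter-all; map-∘; length-filter; reverse-++; ++-identityʳ; ++-assoc; map-replicate; concat-map; concatMap-cong; concatMap-map; map-concatMap; concatMap-++; reverse-map; map-applyUpTo; length-applyUpTo)
open import Data.List.Membership.Propositional using (_∈_; _∉_; find)
open import Data.List.Membership.Propositional.Properties
  using (∈-upTo⁺; ∈-upTo⁻; ∈-downFrom⁺; ∈-downFrom⁻; ∈-filter⁻; ∈-map⁻; ∈-map⁺)
open import Data.List.Relation.Unary.All using (All; []; _∷_)
import Data.List.Relation.Unary.All as All
import Data.List.Relation.Unary.All.Properties as All
open import Data.List.Relation.Unary.Any using (Any; here; there; any?)
import Data.List.Relation.Unary.Any.Properties as Any
open import Data.List.Relation.Unary.AllPairs using (AllPairs; []; _∷_)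
import Data.List.Relation.Unary.AllPairs as AllPairs
import Data.List.Relation.Unary.AllPairs.Properties as AllPairs
open import Data.List.Relation.Unary.Unique.Propositional using (Unique)
import Data.List.Relation.Unary.Unique.Propositional.Properties as Unique
open import Data.List.Relation.Binary.Sublist.Propositional
  using (_⊆_; []; _∷_; _∷ʳ_; ⊆-refl; ⊆-trans; minimum; from∈)
import Data.List.Relation.Binary.Sublist.Propositional.Properties as Sublist
open import Data.List.Relation.Binary.Pointwise using (Pointwise; []; _∷_)
import Data.List.Relation.Binary.Pointwise as Pointwise
open import Data.Nat
open import Data.Nat.Properties
open import Data.Product using (∃; ∃₂; _×_; _,_; proj₁; proj₂)
open import Data.Sum using (_⊎_; inj₁; inj₂)
open import Function using (_∘_)
open import Relation.Nullary using (¬_; yes; no; ¬?)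
open import Relation.Binary.Definitions using (tri<; tri≈; tri>)
open import Relation.Binary.PropositionalEquality
  using (_≡_; _≢_; refl; sym; trans; cong; cong₂; subst; module ≡-Reasoning)

Sorted : Seq → Set
Sorted = AllPairs _<_

count-++ : ∀ a u v → count a (u ++ v) ≡ count a u + count a v
count-++ a u v = trans (cong length (filter-++ (a ≟_) u v)) (length-++ (filter (a ≟_) u))

count-replicate-self : ∀ a n → count a (replicate n a) ≡ n
count-replicate-self a zero = refl
count-replicate-self a (suc n) =
  trans (cong length (filter-accept (a ≟_) refl)) (cong suc (count-replicate-self a n))

count-replicate-other : ∀ {a b} n → a ≢ b → count a (replicate n b) ≡ 0
count-replicate-other zero a≢b = refl
count-replicate-other (suc n) a≢b =
  trans (cong length (filter-reject (_ ≟_) a≢b)) (count-replicate-other n a≢b)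

count-blowUp : ∀ a j w → count a (blowUp j w) ≡ j * count a w
count-blowUp a j [] = sym (*-zeroʳ j)
count-blowUp a j (b ∷ w) with a ≟ b
... | yes refl = begin
  count a (replicate j a ++ blowUp j w)          ≡⟨ count-++ a (replicate j a) (blowUp j w) ⟩
  count a (replicate j a) + count a (blowUp j w) ≡⟨ cong₂ _+_ (count-replicate-self a j) (count-blowUp a j w) ⟩
  j + j * count a w                              ≡⟨ *-suc j (count a w) ⟨
  j * suc (count a w)                            ≡⟨ cong (j *_) (cong length (filter-accept (a ≟_) refl)) ⟨
  j * count a (a ∷ w)                            ∎
  where open ≡-Reasoning
... | no a≢b = begin
  count a (replicate j b ++ blowUp j w)          ≡⟨ count-++ a (replicate j b) (blowUp j w) ⟩
  count a (replicate j b) + count a (blowUp j w) ≡⟨ cong₂ _+_ (count-replicate-other j a≢b) (count-blowUp a j w) ⟩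
  j * count a w                                  ≡⟨ cong (j *_) (cong length (filter-reject (a ≟_) a≢b)) ⟨
  j * count a (b ∷ w)                            ∎
  where open ≡-Reasoning

count-unique : ∀ {a w} → Unique w → a ∈ w → count a w ≡ 1
count-unique {a} (a∉w ∷ _) (here refl) =
  cong length (trans (filter-accept (a ≟_) refl)
                     (cong (a ∷_) (filter-none (a ≟_) a∉w)))
count-unique {a} (b∉w ∷ u) (there a∈w) =
  trans (cong length (filter-reject (a ≟_) (λ { refl → All.lookup b∉w a∈w refl })))
        (count-unique u a∈w)

All-blowUp⁺ : ∀ {P : ℕ → Set} j {w} → All P w → All P (blowUp j w)
All-blowUp⁺ j pw = All.concat⁺ (All.map⁺ (All.map (All.replicate⁺ j) pw))

AllPairs-blowUp⁺ : ∀ {R : ℕ → ℕ → Set} j {w} → (∀ {x} → R x x) → AllPairs R w → AllPairs R (blowUp j w)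
AllPairs-blowUp⁺ j R-refl [] = []
AllPairs-blowUp⁺ {R} j {x ∷ w} R-refl (Rx ∷ Rw) =
  AllPairs.++⁺ (replicate-pairs j) (AllPairs-blowUp⁺ j R-refl Rw)
               (All.replicate⁺ j (All-blowUp⁺ j Rx))
  where
  replicate-pairs : ∀ n → AllPairs R (replicate n x)
  replicate-pairs zero = []
  replicate-pairs (suc n) = All.replicate⁺ n R-refl ∷ replicate-pairs n

AllPairs-⊆ : ∀ {R : ℕ → ℕ → Set} {xs ys} → xs ⊆ ys → AllPairs R ys → AllPairs R xs
AllPairs-⊆ [] [] = []
AllPairs-⊆ (y ∷ʳ p) (_ ∷ Rys) = AllPairs-⊆ p Rys
AllPairs-⊆ (refl ∷ p) (Ry ∷ Rys) = Sublist.All-resp-⊆ p Ry ∷ AllPairs-⊆ p Rys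

AllPairs-pair : ∀ {R : ℕ → ℕ → Set} {x y B} → AllPairs R B → x ∷ y ∷ [] ⊆ B → R x y
AllPairs-pair RB p with AllPairs-⊆ p RB
... | (Rxy ∷ []) ∷ _ = Rxy

fatPerm-blowUp : ∀ {r w} → Unique w → (∀ {a} → a ∈ w → a < r) → (∀ {a} → a < r → a ∈ w) →
  FatPerm r r (blowUp r w)
fatPerm-blowUp {r} {w} uw sound complete =
  (λ a∈ → All.lookup (All-blowUp⁺ r (All.tabulate sound)) a∈) ,
  λ a a<r → begin
    count a (blowUp r w) ≡⟨ count-blowUp a r w ⟩
    r * count a w        ≡⟨ cong (r *_) (count-unique uw (complete a<r)) ⟩
    r * 1                ≡⟨ *-identityʳ r ⟩
    r                    ∎
  where open ≡-Reasoning

ascendingBlock descendingBlock : ℕ → Seq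
ascendingBlock r = blowUp r (upTo r)
descendingBlock r = blowUp r (downFrom r)

fatPerm-ascendingBlock : ∀ r → FatPerm r r (ascendingBlock r)
fatPerm-ascendingBlock r = fatPerm-blowUp (Unique.upTo⁺ r) ∈-upTo⁻ ∈-upTo⁺

fatPerm-descendingBlock : ∀ r → FatPerm r r (descendingBlock r)
fatPerm-descendingBlock r = fatPerm-blowUp (Unique.downFrom⁺ r) ∈-downFrom⁻ ∈-downFrom⁺

ascendingBlock-no-descent : ∀ r {a c} → a < c → ¬ (c ∷ a ∷ [] ⊆ ascendingBlock r)
ascendingBlock-no-descent r a<c p = <⇒≱ a<c (AllPairs-pair ascending p)
  where
  ascending : AllPairs _≤_ (ascendingBlock r)
  ascending = AllPairs-blowUp⁺ r ≤-refl (AllPairs.applyUpTo⁺₁ (λ i → i) r (λ i<j _ → <⇒≤ i<j))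

descendingBlock-no-ascent : ∀ r {a c} → a < c → ¬ (a ∷ c ∷ [] ⊆ descendingBlock r)
descendingBlock-no-ascent r a<c p = <⇒≱ a<c (AllPairs-pair descending p)
  where
  descending : AllPairs _≥_ (descendingBlock r)
  descending = AllPairs-blowUp⁺ r ≤-refl (AllPairs.applyDownFrom⁺₁ (λ i → i) r (λ j<i _ → <⇒≤ j<i))

alternate : {A : Set} → ℕ → A → A → List A
alternate zero x y = []
alternate (suc n) x y = x ∷ alternate n y x

length-alternate : ∀ {A : Set} n (x y : A) → length (alternate n x y) ≡ n
length-alternate zero x y = refl
length-alternate (suc n) x y = cong suc (length-alternate n y x)

alternate-∸2-⊆ : ∀ n (x y : ℕ) → alternate (n ∸ 2) x y ⊆ alternate n x y
alternate-∸2-⊆ zero x y = []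
alternate-∸2-⊆ (suc zero) x y = x ∷ʳ []
alternate-∸2-⊆ (suc (suc n)) x y = x ∷ʳ (y ∷ʳ ⊆-refl)

skip-⊆ : ∀ {x : ℕ} {zs R} B → x ∉ B → x ∷ zs ⊆ B ++ R → x ∷ zs ⊆ R
skip-⊆ [] x∉B p = p
skip-⊆ (b ∷ B) x∉B (.b ∷ʳ p) = skip-⊆ B (x∉B ∘ there) p
skip-⊆ (b ∷ B) x∉B (refl ∷ p) = ⊥-elim (x∉B (here refl))

drop-block-against : ∀ {x y : ℕ} {R} B n → ¬ (y ∷ x ∷ [] ⊆ B) →
  alternate n y x ⊆ B ++ R → alternate n y x ⊆ R ⊎ alternate (n ∸ 1) x y ⊆ R
drop-block-against {R = R} B zero _ _ = inj₁ (minimum R)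
drop-block-against [] (suc n) _ p = inj₁ p
drop-block-against (b ∷ B) (suc n) no-yx (.b ∷ʳ p) = drop-block-against B (suc n) (no-yx ∘ (b ∷ʳ_)) p
drop-block-against {R = R} (b ∷ B) (suc zero) no-yx (refl ∷ p) = inj₂ (minimum R)
drop-block-against (b ∷ B) (suc (suc n)) no-yx (refl ∷ p) =
  inj₂ (skip-⊆ B (λ x∈B → no-yx (refl ∷ from∈ x∈B)) p)

drop-block-along : ∀ {x y : ℕ} {R} B n → ¬ (y ∷ x ∷ [] ⊆ B) →
  alternate n x y ⊆ B ++ R → alternate (n ∸ 2) x y ⊆ R ⊎ alternate (n ∸ 1) y x ⊆ R
drop-block-along {R = R} B zero _ _ = inj₁ (minimum R)
drop-block-along {x} {y} [] n _ p = inj₁ (⊆-trans (alternate-∸2-⊆ n x y) p)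
drop-block-along (b ∷ B) (suc n) no-yx (.b ∷ʳ p) = drop-block-along B (suc n) (no-yx ∘ (b ∷ʳ_)) p
drop-block-along (b ∷ B) (suc n) no-yx (refl ∷ p) with drop-block-against B n (no-yx ∘ (b ∷ʳ_)) p
... | inj₁ q = inj₂ q
... | inj₂ q = inj₁ q

alternate-bound-along : ∀ {x y : ℕ} s {B B'} n → ¬ (y ∷ x ∷ [] ⊆ B) → ¬ (x ∷ y ∷ [] ⊆ B') →
  alternate n x y ⊆ concat (alternate s B B') → n ≤ suc s
alternate-bound-against : ∀ {x y : ℕ} s {B B'} n → ¬ (y ∷ x ∷ [] ⊆ B) → ¬ (x ∷ y ∷ [] ⊆ B') →
  alternate n y x ⊆ concat (alternate s B B') → n ≤ s

alternate-bound-along {x} {y} zero n _ _ p =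
  ≤-trans (≤-reflexive (sym (length-alternate n x y))) (m≤n⇒m≤1+n (Sublist.length-mono-≤ p))
alternate-bound-along (suc s) {B} n no-yx no-xy p with drop-block-along B n no-yx p
... | inj₁ q = ≤-trans (m≤n+m∸n n 2) (+-monoʳ-≤ 2 (alternate-bound-against s (n ∸ 2) no-xy no-yx q))
... | inj₂ q = ≤-trans (m≤n+m∸n n 1) (s≤s (alternate-bound-along s (n ∸ 1) no-xy no-yx q))

alternate-bound-against {x} {y} zero n _ _ p =
  ≤-trans (≤-reflexive (sym (length-alternate n y x))) (Sublist.length-mono-≤ p)
alternate-bound-against (suc s) {B} n no-yx no-xy p with drop-block-against B n no-yx p
... | inj₁ q = alternate-bound-along s n no-xy no-yx q
... | inj₂ q = ≤-trans (m≤n+m∸n n 1) (s≤s (alternate-bound-against s (n ∸ 1) no-xy no-yx q))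

All-alternate : ∀ {A : Set} {P : A → Set} n {x y} → P x → P y → All P (alternate n x y)
All-alternate zero px py = []
All-alternate (suc n) px py = px ∷ All-alternate n py px

map-alternate : ∀ (f : ℕ → ℕ) n x y → map f (alternate n x y) ≡ alternate n (f x) (f y)
map-alternate f zero x y = refl
map-alternate f (suc n) x y = cong (f x ∷_) (map-alternate f n y x)

pow-pair : ∀ (x y : ℕ) t → pow (x ∷ y ∷ []) t ≡ alternate (2 * t) x y
pow-pair x y zero = refl
pow-pair x y (suc t) = trans (cong (λ w → x ∷ y ∷ w) (pow-pair x y t)) (cong (λ n → alternate n x y) (sym (*-suc 2 t)))

pow-⊆ : ∀ {X Y : Seq} t → X ⊆ Y → pow X t ⊆ pow Y t
pow-⊆ zero p = []
pow-⊆ (suc t) p = Sublist.++⁺ p (pow-⊆ t p)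

⊆-blowUp : ∀ j → 1 ≤ j → (X : Seq) → X ⊆ blowUp j X
⊆-blowUp (suc j) _ [] = []
⊆-blowUp (suc j) j≥1 (x ∷ X) = refl ∷ Sublist.++⁺ˡ (replicate j x) (⊆-blowUp (suc j) j≥1 X)

blowUp-⊆ : ∀ j {X Y} → X ⊆ Y → blowUp j X ⊆ blowUp j Y
blowUp-⊆ j [] = []
blowUp-⊆ j (y ∷ʳ p) = Sublist.++⁺ˡ (replicate j y) (blowUp-⊆ j p)
blowUp-⊆ j (refl ∷ p) = Sublist.++⁺ ⊆-refl (blowUp-⊆ j p)

∈-∷⁻-< : ∀ {y z} {Y : Seq} → z ∈ y ∷ Y → y < z → z ∈ Y
∈-∷⁻-< (here refl) y<z = ⊥-elim (<-irrefl refl y<z)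
∈-∷⁻-< (there z∈Y) _ = z∈Y

sorted-⊆ : ∀ {X Y} → Sorted X → Sorted Y → All (_∈ Y) X → X ⊆ Y
sorted-⊆ {[]} {Y} _ _ _ = minimum Y
sorted-⊆ {x ∷ X} {[]} _ _ (() ∷ _)
sorted-⊆ {x ∷ X} {y ∷ Y} (x<X ∷ sX) (y<Y ∷ sY) (here refl ∷ X⊆) =
  refl ∷ sorted-⊆ sX sY (All.zipWith (λ (z∈ , x<z) → ∈-∷⁻-< z∈ x<z) (X⊆ , x<X))
sorted-⊆ {x ∷ X} {y ∷ Y} (x<X ∷ sX) (y<Y ∷ sY) (there x∈Y ∷ X⊆) =
  y ∷ʳ sorted-⊆ (x<X ∷ sX) sY (x∈Y ∷ All.zipWith (λ (z∈ , x<z) → ∈-∷⁻-< z∈ (<-trans y<x x<z)) (X⊆ , x<X))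
  where y<x = All.lookup y<Y x∈Y

sorted-incr : ∀ k → Sorted (incr k)
sorted-incr k = AllPairs.map⁺ (AllPairs.applyUpTo⁺₁ (λ i → i) k (λ i<j _ → s≤s i<j))

ends-⊆-incr : ∀ k → 2 ≤ k → 1 ∷ k ∷ [] ⊆ incr k
ends-⊆-incr (suc k) (s≤s 1≤k) =
  sorted-⊆ ((s≤s 1≤k ∷ []) ∷ [] ∷ []) (sorted-incr (suc k))
           (∈-map⁺ suc (∈-upTo⁺ (s≤s z≤n)) ∷ ∈-map⁺ suc (∈-upTo⁺ ≤-refl) ∷ [])

alternate-⊆-increasing : ∀ k t j → 2 ≤ k → 1 ≤ j → alternate (2 * t) 1 k ⊆ blowUp j (pow (incr k) t)
alternate-⊆-increasing k t j k≥2 j≥1 =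
  subst (_⊆ blowUp j (pow (incr k) t)) (pow-pair 1 k t)
        (⊆-trans (pow-⊆ t (ends-⊆-incr k k≥2)) (⊆-blowUp j j≥1 (pow (incr k) t)))

alternate-⊆-decreasing : ∀ k t j → 2 ≤ k → 1 ≤ j → alternate (2 * t) k 1 ⊆ blowUp j (pow (decr k) t)
alternate-⊆-decreasing k t j k≥2 j≥1 =
  subst (_⊆ blowUp j (pow (decr k) t)) (pow-pair k 1 t)
        (⊆-trans (pow-⊆ t (Sublist.reverse⁺ (ends-⊆-incr k k≥2))) (⊆-blowUp j j≥1 (pow (decr k) t)))

OrderContains-⊆ : ∀ {S u v} → v ⊆ u → OrderContains S u → OrderContains S v
OrderContains-⊆ v⊆u (f , mono , fu⊆S) =
  f , (λ x∈ y∈ → mono (Sublist.Any-resp-⊆ v⊆u x∈) (Sublist.Any-resp-⊆ v⊆u y∈)) ,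
  ⊆-trans (Sublist.map⁺ f v⊆u) fu⊆S

OrderContains-alternate : ∀ {S x y} n → 2 ≤ n → OrderContains S (alternate n x y) →
  ∃₂ λ a c → alternate n a c ⊆ S × (x < y → a < c) × (y < x → c < a)
OrderContains-alternate {S} {x} {y} (suc (suc n)) (s≤s (s≤s z≤n)) (f , mono , fu⊆S) =
  f x , f y , subst (_⊆ S) (map-alternate f (suc (suc n)) x y) fu⊆S ,
  mono (here refl) (there (here refl)) , mono (there (here refl)) (here refl)

Γ : ℕ → ℕ → ℕ → List Seq
Γ k t j = blowUp j (pow (incr k) t) ∷ blowUp j (pow (decr k) t) ∷ []

dfw-lower : ∀ k t j → 2 ≤ k → 1 ≤ t → 1 ≤ j → ∀ s → DfwHolds (Γ k t j) s → 2 * t ∸ 1 ≤ s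
dfw-lower k t j k≥2 t≥1 j≥1 s (r , contains) = bound (contains (concat blocks) formation)
  where
  blocks : List Seq
  blocks = alternate s (ascendingBlock r) (descendingBlock r)

  formation : Formation r r s (concat blocks)
  formation = blocks , length-alternate s _ _ ,
              All-alternate s (fatPerm-ascendingBlock r) (fatPerm-descendingBlock r) , refl

  2≤2t : 2 ≤ 2 * t
  2≤2t = *-monoʳ-≤ 2 t≥1

  bound : Any (OrderContains (concat blocks)) (Γ k t j) → 2 * t ∸ 1 ≤ s
  bound (here γ₁) with OrderContains-alternate (2 * t) 2≤2t
                         (OrderContains-⊆ (alternate-⊆-increasing k t j k≥2 j≥1) γ₁)
  ... | a , c , p , a<c , _ =
    m≤n+o⇒m∸n≤o (2 * t) 1
      (alternate-bound-along s (2 * t) (ascendingBlock-no-descent r (a<c k≥2)) (descendingBlock-no-ascent r (a<c k≥2)) p)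
  bound (there (here γ₂)) with OrderContains-alternate (2 * t) 2≤2t
                                (OrderContains-⊆ (alternate-⊆-decreasing k t j k≥2 j≥1) γ₂)
  ... | a , c , p , _ , c<a =
    ≤-trans (m∸n≤m (2 * t) 1)
      (alternate-bound-against s (2 * t) (ascendingBlock-no-descent r (c<a k≥2)) (descendingBlock-no-ascent r (c<a k≥2)) p)

replicate-⊆ : ∀ n x u → n ≤ count x u → replicate n x ⊆ u
replicate-⊆ zero x u _ = minimum u
replicate-⊆ (suc n) x (b ∷ u) n≤cx with x ≟ b
... | yes refl = refl ∷ replicate-⊆ n x u (s≤s⁻¹ (subst (suc n ≤_) (cong length (filter-accept (x ≟_) refl)) n≤cx))
... | no x≢b = b ∷ʳ replicate-⊆ (suc n) x u (subst (suc n ≤_) (cong length (filter-reject (x ≟_) x≢b)) n≤cx)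

length-remove : ∀ {x L} → Unique L → x ∈ L → suc (length (filter (¬? ∘ (x ≟_)) L)) ≡ length L
length-remove {x} (x∉L ∷ _) (here refl) =
  cong (suc ∘ length) (trans (filter-reject (¬? ∘ (x ≟_)) (λ x≢x → x≢x refl))
                             (filter-all (¬? ∘ (x ≟_)) x∉L))
length-remove {x} (y∉L ∷ uL) (there x∈L) =
  trans (cong (suc ∘ length) (filter-accept (¬? ∘ (x ≟_)) (λ { refl → All.lookup y∉L x∈L refl })))
        (cong suc (length-remove uL x∈L))

firstToReach : ∀ j L p w → All (λ y → count y p < j) L → Any (λ y → j ≤ count y (p ++ w)) L →
  ∃₂ λ u v → w ≡ u ++ v × Any (λ y → j ≤ count y (p ++ u)) L × All (λ y → count y (p ++ u) ≤ j) L
firstToReach j L p [] below reached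
  with All.lookupAny below (subst (λ q → Any (λ y → j ≤ count y q) L) (++-identityʳ p) reached)
... | c<j , j≤c = ⊥-elim (<⇒≱ c<j j≤c)
firstToReach j L p (a ∷ w) below reached with any? (λ y → j ≤? count y (p ++ a ∷ [])) L
... | yes reachedNow = a ∷ [] , w , refl , reachedNow , All.map one-more below
  where
  one-more : ∀ {y} → count y p < j → count y (p ++ a ∷ []) ≤ j
  one-more {y} c<j = begin
    count y (p ++ a ∷ [])         ≡⟨ count-++ y p (a ∷ []) ⟩
    count y p + count y (a ∷ [])  ≤⟨ +-monoʳ-≤ (count y p) (length-filter (y ≟_) (a ∷ [])) ⟩
    count y p + 1                 ≡⟨ +-comm (count y p) 1 ⟩
    suc (count y p)               ≤⟨ c<j ⟩
    j                             ∎
    where open ≤-Reasoning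
... | no notYet with firstToReach j L (p ++ a ∷ []) w (All.map ≰⇒> (All.¬Any⇒All¬ L notYet))
                       (subst (λ q → Any (λ y → j ≤ count y q) L) (sym (++-assoc p (a ∷ []) w)) reached)
... | u , v , refl , reachedU , boundU =
  a ∷ u , v , refl ,
  subst (λ q → Any (λ y → j ≤ count y q) L) (++-assoc p (a ∷ []) u) reachedU ,
  subst (λ q → All (λ y → count y q ≤ j) L) (++-assoc p (a ∷ []) u) boundU

-- Repeatedly take the letter of L that first reaches j occurrences and cut w right after it.
blowUp-extract : ∀ j → 1 ≤ j → ∀ n L w → length L ≡ n → Unique L →
  All (λ y → length L * j ≤ count y w) L →
  ∃ λ π → Unique π × All (_∈ L) π × length π ≡ length L × blowUp j π ⊆ w
blowUp-extract j j≥1 n [] w _ _ _ = [] , [] , [] , refl , minimum w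
blowUp-extract j j≥1 (suc n) L@(y₀ ∷ L₀) w |L|≡n uL enough
  with firstToReach j L [] w (All.tabulate (λ _ → j≥1)) (here (≤-trans (m≤m+n j _) (All.lookup enough (here refl))))
... | u , v , refl , reachedU , boundU with find reachedU
... | x , x∈L , j≤cx with blowUp-extract j j≥1 n L' v |L'|≡n (Unique.filter⁺ (¬? ∘ (x ≟_)) uL) enough'
  where
  L' = filter (¬? ∘ (x ≟_)) L
  |L'|≡n : length L' ≡ n
  |L'|≡n = suc-injective (trans (length-remove uL x∈L) |L|≡n)
  enough' : All (λ y → length L' * j ≤ count y v) L'
  enough' = All.tabulate λ {y} y∈L' → +-cancelˡ-≤ j _ _ (begin
    j + length L' * j          ≡⟨ cong (_* j) (length-remove uL x∈L) ⟩
    length L * j               ≤⟨ All.lookup enough (proj₁ (∈-filter⁻ (¬? ∘ (x ≟_)) y∈L')) ⟩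
    count y (u ++ v)           ≡⟨ count-++ y u v ⟩
    count y u + count y v      ≤⟨ +-monoˡ-≤ (count y v) (All.lookup boundU (proj₁ (∈-filter⁻ (¬? ∘ (x ≟_)) y∈L'))) ⟩
    j + count y v              ∎)
    where open ≤-Reasoning
... | π , uπ , π⊆L' , |π|≡|L'| , sub =
  x ∷ π ,
  All.map (proj₂ ∘ ∈-filter⁻ (¬? ∘ (x ≟_))) π⊆L' ∷ uπ ,
  x∈L ∷ All.map (proj₁ ∘ ∈-filter⁻ (¬? ∘ (x ≟_))) π⊆L' ,
  trans (cong suc |π|≡|L'|) (length-remove uL x∈L) ,
  Sublist.++⁺ (replicate-⊆ j x u j≤cx) sub

orient : Bool → Seq → Seq
orient true M = M
orient false M = reverse M

orient-⊆ : ∀ d {X Y} → X ⊆ Y → orient d X ⊆ orient d Y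
orient-⊆ true p = p
orient-⊆ false p = Sublist.reverse⁺ p

∈-orient⁺ : ∀ d {x M} → x ∈ M → x ∈ orient d M
∈-orient⁺ true x∈M = x∈M
∈-orient⁺ false x∈M = Any.reverse⁺ x∈M

MonotoneSublist : ℕ → ℕ → Seq → Set
MonotoneSublist a b π =
  ∃₂ λ M d → Sorted M × orient d M ⊆ π × (if d then a else b) ≤ length M

MonotoneSublist-⊆ : ∀ {a b π π'} → π' ⊆ π → MonotoneSublist a b π' → MonotoneSublist a b π
MonotoneSublist-⊆ π'⊆π (M , d , sM , M⊆π' , long) = M , d , sM , ⊆-trans M⊆π' π'⊆π , long

split-length : ∀ x π → All (x ≢_) π → length π ≤ length (filter (x <?_) π) + length (filter (_<? x) π)
split-length x [] _ = z≤n
split-length x (y ∷ π) (x≢y ∷ x∉π) with <-cmp x y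
... | tri< x<y _ _ rewrite filter-accept (x <?_) {y} {π} x<y | filter-reject (_<? x) {y} {π} (<⇒≯ x<y) =
  s≤s (split-length x π x∉π)
... | tri≈ _ x≡y _ = ⊥-elim (x≢y x≡y)
... | tri> _ _ y<x rewrite filter-reject (x <?_) {y} {π} (<⇒≯ y<x) | filter-accept (_<? x) {y} {π} y<x
                         | +-suc (length (filter (x <?_) π)) (length (filter (_<? x) π)) =
  s≤s (split-length x π x∉π)

half-≤-summand : ∀ N p q → N + N ≤ suc (p + q) → N ≤ p ⊎ N ≤ q
half-≤-summand N p q 2N≤ with N ≤? p
... | yes N≤p = inj₁ N≤p
... | no N≰p = inj₂ (+-cancelˡ-≤ N N q (≤-trans 2N≤ (+-monoˡ-≤ q (≰⇒> N≰p))))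

-- Split π after its first letter x into the letters above and below x; one part has half of them.
erdős-szekeres : ∀ a b π → Unique π → 2 ^ (a + b) ≤ length π → MonotoneSublist a b π
erdős-szekeres zero b π _ _ = [] , true , [] , minimum π , z≤n
erdős-szekeres (suc a) zero π _ _ = [] , false , [] , minimum π , z≤n
erdős-szekeres (suc a) (suc b) [] _ big = ⊥-elim (<⇒≱ (m^n>0 2 (suc a + suc b)) big)
erdős-szekeres (suc a) (suc b) (x ∷ π) (x∉π ∷ uπ) big
  with half-≤-summand (2 ^ (a + suc b)) (length above) (length below)
            (≤-trans (subst (_≤ suc (length π)) (cong (2 ^ (a + suc b) +_) (+-identityʳ _)) big)
                     (s≤s (split-length x π x∉π)))
  where
  above = filter (x <?_) π
  below = filter (_<? x) π
... | inj₁ many-above with erdős-szekeres a (suc b) (filter (x <?_) π) (Unique.filter⁺ (x <?_) uπ) many-above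
...   | M , true , sM , M⊆ , long =
  x ∷ M , true , Sublist.All-resp-⊆ M⊆ (All.all-filter (x <?_) π) ∷ sM ,
  refl ∷ ⊆-trans M⊆ (Sublist.filter-⊆ (x <?_) π) , s≤s long
...   | M , false , sM , M⊆ , long =
  M , false , sM , x ∷ʳ ⊆-trans M⊆ (Sublist.filter-⊆ (x <?_) π) , long
erdős-szekeres (suc a) (suc b) (x ∷ π) (x∉π ∷ uπ) big | inj₂ many-below
  with erdős-szekeres (suc a) b (filter (_<? x) π) (Unique.filter⁺ (_<? x) uπ)
         (subst (λ n → 2 ^ n ≤ length (filter (_<? x) π)) (+-suc a b) many-below)
...   | M , true , sM , M⊆ , long =
  M , true , sM , x ∷ʳ ⊆-trans M⊆ (Sublist.filter-⊆ (_<? x) π) , long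
...   | M , false , sM , M⊆ , long =
  M ++ x ∷ [] , false ,
  AllPairs.++⁺ sM ([] ∷ []) (All.tabulate λ z∈M → All.lookup below-x (Any.reverse⁺ z∈M) ∷ []) ,
  subst (_⊆ x ∷ π) (sym (reverse-++ M (x ∷ []))) (refl ∷ ⊆-trans M⊆ (Sublist.filter-⊆ (_<? x) π)) ,
  subst (suc b ≤_) (sym (trans (length-++ M) (+-comm (length M) 1))) (s≤s long)
  where
  below-x : All (_< x) (reverse M)
  below-x = Sublist.All-resp-⊆ M⊆ (All.all-filter (_<? x) π)

if-same : ∀ d (n : ℕ) → (if d then n else n) ≡ n
if-same true n = refl
if-same false n = refl

monotone-block : ∀ j → 1 ≤ j → ∀ {r} n {K w} → FatPerm r r w → Sorted K → All (_< r) K →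
  length K * j ≤ r → 2 ^ (n + n) ≤ length K →
  ∃₂ λ M d → M ⊆ K × n ≤ length M × blowUp j (orient d M) ⊆ w
monotone-block j j≥1 {r} n {K} {w} (_ , fat) sK K<r |K|j≤r big
  with blowUp-extract j j≥1 (length K) K w refl (AllPairs.map <⇒≢ sK)
         (All.map (λ y<r → subst (length K * j ≤_) (sym (fat _ y<r)) |K|j≤r) K<r)
... | π , uπ , π⊆K , |π|≡|K| , πw
  with erdős-szekeres n n π uπ (subst (2 ^ (n + n) ≤_) (sym |π|≡|K|) big)
... | M , d , sM , Mπ , long =
  M , d , sorted-⊆ sM sK (All.tabulate λ z∈M → All.lookup π⊆K (Sublist.Any-resp-⊆ Mπ (∈-orient⁺ d z∈M))) ,
  subst (_≤ length M) (if-same d n) long , ⊆-trans (blowUp-⊆ j Mπ) πw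

-- need k i letters suffice to keep k letters through i fat permutations, by erdős-szekeres.
need : ℕ → ℕ → ℕ
need k zero = k
need k (suc i) = 2 ^ (need k i + need k i)

BlownUpIn : ℕ → Seq → Bool → Seq → Set
BlownUpIn j K d w = blowUp j (orient d K) ⊆ w

monotone-in-every-block : ∀ j → 1 ≤ j → ∀ {r} k ws {K} → All (FatPerm r r) ws → Sorted K → All (_< r) K →
  length K * j ≤ r → need k (length ws) ≤ length K →
  ∃₂ λ K' ds → K' ⊆ K × k ≤ length K' × Pointwise (BlownUpIn j K') ds ws
monotone-in-every-block j j≥1 k [] {K} [] sK K<r |K|j≤r big = K , [] , ⊆-refl , big , []
monotone-in-every-block j j≥1 k (w ∷ ws) (fp ∷ fps) sK K<r |K|j≤r big
  with monotone-block j j≥1 (need k (length ws)) fp sK K<r |K|j≤r big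
... | M , d , M⊆K , long , Mw
  with monotone-in-every-block j j≥1 k ws fps (AllPairs-⊆ M⊆K sK) (Sublist.All-resp-⊆ M⊆K K<r)
         (≤-trans (*-monoˡ-≤ j (Sublist.length-mono-≤ M⊆K)) |K|j≤r) long
... | K' , ds , K'⊆M , k≤|K'| , K'ws =
  K' , d ∷ ds , ⊆-trans K'⊆M M⊆K , k≤|K'| , ⊆-trans (blowUp-⊆ j (orient-⊆ d K'⊆M)) Mw ∷ K'ws

oriented-powers : ∀ {X : Bool → Seq} {ds ws} → Pointwise (λ d w → X d ⊆ w) ds ws →
  ∀ a b → a + b ≤ suc (length ws) → pow (X true) a ⊆ concat ws ⊎ pow (X false) b ⊆ concat ws
oriented-powers {ws = ws} _ zero b _ = inj₁ (minimum (concat ws))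
oriented-powers {ws = ws} _ (suc a) zero _ = inj₂ (minimum (concat ws))
oriented-powers [] (suc a) (suc b) (s≤s a+b≤0) with ≤-trans (m≤n+m (suc b) a) a+b≤0
... | ()
oriented-powers {ws = w ∷ _} (_∷_ {x = true} Xw Xws) (suc a) b (s≤s a+b≤) with oriented-powers Xws a b a+b≤
... | inj₁ p = inj₁ (Sublist.++⁺ Xw p)
... | inj₂ q = inj₂ (Sublist.++⁺ˡ w q)
oriented-powers {X} {ws = w ∷ ws} (_∷_ {x = false} Xw Xws) a (suc b) a+b≤
  with oriented-powers Xws a b (s≤s⁻¹ (subst (_≤ suc (suc (length ws))) (+-suc a b) a+b≤))
... | inj₁ p = inj₁ (Sublist.++⁺ˡ w p)
... | inj₂ q = inj₂ (Sublist.++⁺ Xw q)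

nth : Seq → ℕ → ℕ
nth [] i = 0
nth (x ∷ K) zero = x
nth (x ∷ K) (suc i) = nth K i

nth-∈ : ∀ K {i} → i < length K → nth K i ∈ K
nth-∈ (x ∷ K) {zero} _ = here refl
nth-∈ (x ∷ K) {suc i} (s≤s i<|K|) = there (nth-∈ K i<|K|)

nth-mono : ∀ {K i i'} → Sorted K → i < i' → i' < length K → nth K i < nth K i'
nth-mono {x ∷ K} {zero} {suc i'} (x<K ∷ _) _ (s≤s i'<|K|) = All.lookup x<K (nth-∈ K i'<|K|)
nth-mono {x ∷ K} {suc i} {suc i'} (_ ∷ sK) (s≤s i<i') (s≤s i'<|K|) = nth-mono sK i<i' i'<|K|

applyUpTo-nth : ∀ k K → k ≤ length K → applyUpTo (nth K) k ≡ take k K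
applyUpTo-nth zero K _ = refl
applyUpTo-nth (suc k) (x ∷ K) (s≤s k≤|K|) = cong (x ∷_) (applyUpTo-nth k K k≤|K|)

map-blowUp : ∀ (f : ℕ → ℕ) j X → map f (blowUp j X) ≡ blowUp j (map f X)
map-blowUp f j X = begin
  map f (concatMap (replicate j) X)     ≡⟨ map-concatMap f (replicate j) X ⟩
  concatMap (map f ∘ replicate j) X     ≡⟨ concatMap-cong (map-replicate f j) X ⟩
  concatMap (replicate j ∘ f) X         ≡⟨ concatMap-map (replicate j) f X ⟨
  concatMap (replicate j) (map f X)     ∎
  where open ≡-Reasoning

map-pow : ∀ (f : ℕ → ℕ) X t → map f (pow X t) ≡ pow (map f X) t
map-pow f X t = trans (sym (concat-map (replicate t X))) (cong concat (map-replicate (map f) t X))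

blowUp-pow : ∀ j X t → blowUp j (pow X t) ≡ pow (blowUp j X) t
blowUp-pow j X zero = refl
blowUp-pow j X (suc t) = trans (concatMap-++ (replicate j) X (pow X t)) (cong (blowUp j X ++_) (blowUp-pow j X t))

map-orient : ∀ (f : ℕ → ℕ) d X → map f (orient d X) ≡ orient d (map f X)
map-orient f true X = refl
map-orient f false X = reverse-map f X

∈-blowUp-pow⁻ : ∀ {x} j X t → x ∈ blowUp j (pow X t) → x ∈ X
∈-blowUp-pow⁻ j X t = All.lookup (All-blowUp⁺ j (All.concat⁺ (All.replicate⁺ t (All.tabulate (λ x∈X → x∈X)))))

∈-orient⁻ : ∀ d {x M} → x ∈ orient d M → x ∈ M
∈-orient⁻ true x∈M = x∈M
∈-orient⁻ false x∈M = Any.reverse⁻ x∈M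

-- Letter i ≥ 1 is renamed to the i-th letter of K; d = true gives γ₁ and d = false gives γ₂.
OrderContains-orient-incr : ∀ {S K} k j t d → Sorted K → k ≤ length K →
  pow (blowUp j (orient d (take k K))) t ⊆ S → OrderContains S (blowUp j (pow (orient d (incr k)) t))
OrderContains-orient-incr {S} {K} k j t d sK k≤|K| p =
  f , (λ x∈ y∈ → mono (letter x∈) (letter y∈)) , subst (_⊆ S) (sym image) p
  where
  f : ℕ → ℕ
  f i = nth K (pred i)

  letter : ∀ {x} → x ∈ blowUp j (pow (orient d (incr k)) t) → x ∈ incr k
  letter x∈ = ∈-orient⁻ d (∈-blowUp-pow⁻ j (orient d (incr k)) t x∈)

  mono : ∀ {x y} → x ∈ incr k → y ∈ incr k → x < y → f x < f y
  mono x∈ y∈ x<y with ∈-map⁻ suc x∈ | ∈-map⁻ suc y∈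
  ... | i , _ , refl | i' , i'∈ , refl = nth-mono sK (s≤s⁻¹ x<y) (≤-trans (∈-upTo⁻ i'∈) k≤|K|)

  incr-image : map f (incr k) ≡ take k K
  incr-image = trans (sym (map-∘ (upTo k))) (trans (map-applyUpTo (λ i → i) (nth K) k) (applyUpTo-nth k K k≤|K|))

  image : map f (blowUp j (pow (orient d (incr k)) t)) ≡ pow (blowUp j (orient d (take k K))) t
  image = begin
    map f (blowUp j (pow (orient d (incr k)) t))  ≡⟨ map-blowUp f j (pow (orient d (incr k)) t) ⟩
    blowUp j (map f (pow (orient d (incr k)) t))  ≡⟨ cong (blowUp j) (map-pow f (orient d (incr k)) t) ⟩
    blowUp j (pow (map f (orient d (incr k))) t)  ≡⟨ cong (λ X → blowUp j (pow X t)) (map-orient f d (incr k)) ⟩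
    blowUp j (pow (orient d (map f (incr k))) t)  ≡⟨ cong (λ X → blowUp j (pow (orient d X) t)) incr-image ⟩
    blowUp j (pow (orient d (take k K)) t)        ≡⟨ blowUp-pow j (orient d (take k K)) t ⟩
    pow (blowUp j (orient d (take k K))) t        ∎
    where open ≡-Reasoning

dfw-upper : ∀ k t j → 1 ≤ j → DfwHolds (Γ k t j) (2 * t ∸ 1)
dfw-upper k t j j≥1 = m * j , contains
  where
  m : ℕ
  m = need k (2 * t ∸ 1)

  sorted-upTo : Sorted (upTo m)
  sorted-upTo = AllPairs.applyUpTo⁺₁ (λ i → i) m (λ i<i' _ → i<i')

  upTo<m*j : All (_< m * j) (upTo m)
  upTo<m*j = All.tabulate λ i∈ → ≤-trans (∈-upTo⁻ i∈) (≤-trans (≤-reflexive (sym (*-identityʳ m))) (*-monoʳ-≤ m j≥1))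

  |upTo|≡m : length (upTo m) ≡ m
  |upTo|≡m = length-applyUpTo (λ i → i) m

  contains : ∀ S → Formation (m * j) (m * j) (2 * t ∸ 1) S → Any (OrderContains S) (Γ k t j)
  contains S (ws , |ws| , fps , refl)
    with monotone-in-every-block j j≥1 k ws fps sorted-upTo upTo<m*j (≤-reflexive (cong (_* j) |upTo|≡m))
           (≤-reflexive (trans (cong (need k) |ws|) (sym |upTo|≡m)))
  ... | K , ds , K⊆ , k≤|K| , Kws
    with oriented-powers {X = λ d → blowUp j (orient d (take k K))}
           (Pointwise.map (λ {d} → ⊆-trans (blowUp-⊆ j (orient-⊆ d (Sublist.take-⊆ k K)))) Kws) t t
           (subst (λ n → t + t ≤ suc n) (sym |ws|)
                  (≤-trans (≤-reflexive (cong (t +_) (sym (+-identityʳ t)))) (m≤n+m∸n (2 * t) 1)))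
  ... | inj₁ p = here (OrderContains-orient-incr k j t true (AllPairs-⊆ K⊆ sorted-upTo) k≤|K| p)
  ... | inj₂ p = there (here (OrderContains-orient-incr k j t false (AllPairs-⊆ K⊆ sorted-upTo) k≤|K| p))

mainTheorem4 : (k t j : ℕ) → 2 ≤ k → 1 ≤ t → 1 ≤ j →
    DfwIs (blowUp j (pow (incr k) t) ∷ blowUp j (pow (decr k) t) ∷ []) (2 * t ∸ 1)
mainTheorem4 k t j k≥2 t≥1 j≥1 = dfw-upper k t j j≥1 , dfw-lower k t j k≥2 t≥1 j≥1
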